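{- The calculus PC is sound with respect to $\vDash_{PC}$: every formula of $\mathcal{L}_{PC}$ derivable in PC is true at every world of every conditional neighbourhood model under $\vDash_{PC}$.
   Context: Fix a set $P$ of proposition letters and a finite set $Ag$ of agents. The language $\mathcal{L}_{PC}$ is $\phi::=\top\mid p\mid\neg\phi\mid(\phi\wedge\phi)\mid B_a(\phi,\phi)\mid[\phi]\phi$ ($p\in P$, $a\in Ag$); $\bot,\vee,\to,\leftrightarrow$ as usual, $K_a\phi:=\neg B_a(\neg\phi,\top)$, $\check K_a\phi:=\neg K_a\neg\phi$. A conditional neighbourhood model is $\mathfrak{M}=(W,N,V)$: $W$ non-empty, $V:P\to\mathcal{P}(W)$, and $N$ assigns to each $a\in Ag$, $w\in W$, $X\subseteq W$ a set $N_a^w(X)\subseteq\mathcal{P}(W)$ such that, writing $[w]_a=\{v\mid\forall X\subseteq W,\ N_a^w(X)=N_a^v(X)\}$: (c) each $Y\in N_a^w(X)$ has $Y\subseteq X\cap[w]_a$; (ec) if $X\cap[w]_a=Y\cap[w]_a$ then $N_a^w(X)=N_a^w(Y)$; (d) for $Y\in N_a^w(X)$, $(X\cap[w]_a)\setminus Y\notin N_a^w(X)$; (sc) for $Y,Z\subseteq X\cap[w]_a$, if $(X\cap[w]_a)\setminus Y\notin N_a^w(X)$ and $Y\subsetneq Z$ then $Z\in N_a^w(X)$. Semantics $\vDash_{PC}$: $\top$ always true; $p$ iff $w\in V(p)$; Booleans as usual; $\mathfrak{M},w\vDash B_a(\phi,\psi)$ iff some $Y\in N_a^w(\llbracket\phi\rrbracket_{\mathfrak{M}})$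 has $Y\subseteq\llbracket\psi\rrbracket_{\mathfrak{M}}$ (where $\llbracket\phi\rrbracket_{\mathfrak{M}}=\{v\mid\mathfrak{M},v\vDash\phi\}$); $\mathfrak{M},w\vDash[\phi]\psi$ iff ($\mathfrak{M},w\vDash\phi$ implies $\mathfrak{M}^\phi,w\vDash\psi$). Here the update $\mathfrak{M}^\phi=(W^\phi,{}^\phi N,V^\phi)$ has $W^\phi=\llbracket\phi\rrbracket_{\mathfrak{M}}$, ${}^\phi N_a^w(X)=N_a^w(X)$ for $w\in W^\phi$ and $X\subseteq W^\phi$, and $V^\phi(p)=V(p)\cap W^\phi$ (its induced indistinguishability classes are $[w]_a\cap W^\phi$). The calculus PC consists of the CN calculus over $\mathcal{L}_{PC}$ — axioms (Taut) propositional tautologies; (Dist-K) $K_a(\phi\to\psi)\to K_a\phi\to K_a\psi$; (T) $K_a\phi\to\phi$; (5B) $B_a(\phi,\psi)\to K_aB_a(\phi,\psi)$; (4B) $\neg B_a(\phi,\psi)\to K_a\neg B_a(\phi,\psi)$; (D) $B_a(\phi,\psi)\to\neg B_a(\phi,\neg\psi)$; (EC) $K_a(\phi\leftrightarrow\psi)\to B_a(\phi,\chi)\to B_a(\psi,\chi)$; (M) $K_a(\phi\to\psi)\to B_a(\chi,\phi)\to B_a(\chi,\psi)$; (C) $B_a(\phi,\psi)\to B_a(\phi,\phi\wedge\psi)$; (SC) $\neg B_a(\chi,\neg\phi)\wedge\check K_a(\chi\wedge\neg\phi\wedge\psi)\to B_a(\chi,\phi\vee\psi)$; rules Modus Ponens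 and from $\phi$ infer $K_a\phi$ — plus the usual reduction axioms for public announcement: $[\phi]\top\leftrightarrow\top$, $[\phi]p\leftrightarrow(\phi\to p)$, $[\phi]\neg\psi\leftrightarrow(\phi\to\neg[\phi]\psi)$, $[\phi](\psi\wedge\chi)\leftrightarrow([\phi]\psi\wedge[\phi]\chi)$, and $[\phi]B_a(\psi,\chi)\leftrightarrow(\phi\to B_a(\phi\wedge[\phi]\psi,[\phi]\chi))$. -}

module Defs where

open import Level using (0ℓ)
open import Data.Nat using (ℕ)
open import Data.Bool using (Bool; true; false; not; _∧_; T)
open import Data.Unit using (⊤; tt)
open import Data.Product using (Σ; _×_; _,_; proj₁; proj₂; ∃)
open import Relation.Nullary using (¬_; Dec; does; _because_; ofⁿ)
open import Relation.Binary.PropositionalEquality using (_≡_)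
open import Function.Bundles using (_⇔_)
open import Axiom.ExcludedMiddle using (ExcludedMiddle)

data Form (P Ag : Set) : Set where
  ⊤'    : Form P Ag
  atom  : P → Form P Ag
  ¬'_   : Form P Ag → Form P Ag
  _∧'_  : Form P Ag → Form P Ag → Form P Ag
  B     : Ag → Form P Ag → Form P Ag → Form P Ag
  [_]_  : Form P Ag → Form P Ag → Form P Ag

infixr 9 ¬'_
infixr 7 _∧'_

module _ {P Ag : Set} where

  infixr 6 _∨'_
  infixr 5 _⇒_
  infixr 4 _⇔'_

  ⊥' : Form P Ag
  ⊥' = ¬' ⊤'

  _∨'_ : Form P Ag → Form P Ag → Form P Ag
  φ ∨' ψ = ¬' (¬' φ ∧' ¬' ψ)

  _⇒_ : Form P Ag → Form P Ag → Form P Ag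
  φ ⇒ ψ = ¬' (φ ∧' ¬' ψ)

  _⇔'_ : Form P Ag → Form P Ag → Form P Ag
  φ ⇔' ψ = (φ ⇒ ψ) ∧' (ψ ⇒ φ)

  K : Ag → Form P Ag → Form P Ag
  K a φ = ¬' B a (¬' φ) ⊤'

  K̂ : Ag → Form P Ag → Form P Ag
  K̂ a φ = ¬' K a (¬' φ)

data PForm : Set where
  pv   : ℕ → PForm
  p⊤   : PForm
  p¬   : PForm → PForm
  p∧   : PForm → PForm → PForm

evalP : (ℕ → Bool) → PForm → Bool
evalP v (pv i)    = v i
evalP v p⊤        = true
evalP v (p¬ τ)    = not (evalP v τ)
evalP v (p∧ τ σ)  = evalP v τ ∧ evalP v σ

Tautology : PForm → Set
Tautology τ = ∀ (v : ℕ → Bool) → evalP v τ ≡ true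

substP : {P Ag : Set} → (ℕ → Form P Ag) → PForm → Form P Ag
substP σ (pv i)   = σ i
substP σ p⊤       = ⊤'
substP σ (p¬ τ)   = ¬' substP σ τ
substP σ (p∧ τ ρ) = substP σ τ ∧' substP σ ρ

data ⊢_ {P Ag : Set} : Form P Ag → Set where
  Taut   : (τ : PForm) → Tautology τ → (σ : ℕ → Form P Ag) → ⊢ substP σ τ
  DistK  : ∀ a φ ψ → ⊢ (K a (φ ⇒ ψ) ⇒ K a φ ⇒ K a ψ)
  T-ax   : ∀ a φ → ⊢ (K a φ ⇒ φ)
  5B     : ∀ a φ ψ → ⊢ (B a φ ψ ⇒ K a (B a φ ψ))
  4B     : ∀ a φ ψ → ⊢ (¬' B a φ ψ ⇒ K a (¬' B a φ ψ))
  D-ax   : ∀ a φ ψ → ⊢ (B a φ ψ ⇒ ¬' B a φ (¬' ψ))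
  EC     : ∀ a φ ψ χ → ⊢ (K a (φ ⇔' ψ) ⇒ B a φ χ ⇒ B a ψ χ)
  M-ax   : ∀ a φ ψ χ → ⊢ (K a (φ ⇒ ψ) ⇒ B a χ φ ⇒ B a χ ψ)
  C-ax   : ∀ a φ ψ → ⊢ (B a φ ψ ⇒ B a φ (φ ∧' ψ))
  SC     : ∀ a φ ψ χ →
           ⊢ ((¬' B a χ (¬' φ) ∧' K̂ a (χ ∧' ¬' φ ∧' ψ)) ⇒ B a χ (φ ∨' ψ))
  R⊤     : ∀ φ → ⊢ (([ φ ] ⊤') ⇔' ⊤')
  Ratom  : ∀ φ p → ⊢ (([ φ ] atom p) ⇔' (φ ⇒ atom p))
  R¬     : ∀ φ ψ → ⊢ (([ φ ] (¬' ψ)) ⇔' (φ ⇒ ¬' ([ φ ] ψ)))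
  R∧     : ∀ φ ψ χ → ⊢ (([ φ ] (ψ ∧' χ)) ⇔' (([ φ ] ψ) ∧' ([ φ ] χ)))
  RB     : ∀ φ a ψ χ →
           ⊢ (([ φ ] B a ψ χ) ⇔' (φ ⇒ B a (φ ∧' ([ φ ] ψ)) ([ φ ] χ)))
  MP     : ∀ {φ ψ} → ⊢ (φ ⇒ ψ) → ⊢ φ → ⊢ ψ
  Nec    : ∀ a {φ} → ⊢ φ → ⊢ K a φ

Sub : Set → Set
Sub W = W → Bool

_∈_ : {W : Set} → W → Sub W → Set
v ∈ X = X v ≡ true

_≐_ : {W : Set} → Sub W → Sub W → Set
X ≐ Y = ∀ v → X v ≡ Y v

-- Frames (W, N, V) without the conditions; N a w X Y means Y ∈ N_a^w(X)

record Frame (P Ag : Set) : Set₁ where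
  field
    W : Set
    N : Ag → W → Sub W → Sub W → Set
    V : P → Sub W

module _ {P Ag : Set} (F : Frame P Ag) where
  open Frame F

  cls : Ag → W → W → Set
  cls a w v = ∀ (X Y : Sub W) → (N a w X Y ⇔ N a v X Y)

  IsDiff : Ag → W → Sub W → Sub W → Sub W → Set
  IsDiff a w X Y Z = ∀ v → (v ∈ Z ⇔ (v ∈ X × cls a w v × ¬ v ∈ Y))

  ⊆cap : Ag → W → Sub W → Sub W → Set
  ⊆cap a w Y X = ∀ v → v ∈ Y → v ∈ X × cls a w v

  DiffNotIn : Ag → W → Sub W → Sub W → Set
  DiffNotIn a w X Y = ∀ Z → IsDiff a w X Y Z → ¬ N a w X Z

  _⊊_ : Sub W → Sub W → Set
  Y ⊊ Z = (∀ v → v ∈ Y → v ∈ Z) × ∃ λ v → v ∈ Z × ¬ v ∈ Y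

  record IsCNModel : Set where
    field
      nonempty : W
      -- N_a^w(X) is a set of subsets and depends only on the set X
      extN  : ∀ a w X X' Y Y' → X ≐ X' → Y ≐ Y' → N a w X Y → N a w X' Y'
      c-ax  : ∀ a w X Y → N a w X Y → ⊆cap a w Y X
      ec-ax : ∀ a w X Y → (∀ v → cls a w v → (v ∈ X ⇔ v ∈ Y)) →
              ∀ Z → (N a w X Z ⇔ N a w Y Z)
      d-ax  : ∀ a w X Y → N a w X Y → DiffNotIn a w X Y
      sc-ax : ∀ a w X Y Z → ⊆cap a w Y X → ⊆cap a w Z X →
              DiffNotIn a w X Y → Y ⊊ Z → N a w X Z

record CNModel (P Ag : Set) : Set₁ where
  field
    frame : Frame P Ag
    isCN  : IsCNModel frame

-- Semantics ⊨_PC (classical metatheory: excluded middle is a parameter,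
-- used only to form the characteristic function of a truth set)

extB : (b : Bool) → (T b → Bool) → Bool
extB true  f = f tt
extB false f = false

witnessT : {A : Set} (d : Dec A) → A → T (does d)
witnessT (true because _) a = tt
witnessT (false because ofⁿ ¬a) a = ¬a a

module Semantics (em : ExcludedMiddle 0ℓ) {P Ag : Set} where

  mutual
    _,_⊨_ : (M : Frame P Ag) → Frame.W M → Form P Ag → Set

    ⟦_⟧ : (M : Frame P Ag) → Form P Ag → Sub (Frame.W M)
    ⟦ M ⟧ φ v = does (em {M , v ⊨ φ})

    -- the updated model M^φ: W^φ = ⟦φ⟧, N restricted to subsets of W^φ,
    -- V^φ(p) = V(p) ∩ W^φ
    update : Frame P Ag → Form P Ag → Frame P Ag
    update M φ = record
      { W = Σ (Frame.W M) (λ v → T (⟦ M ⟧ φ v))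
      ; N = λ a w X Y → Frame.N M a (proj₁ w)
                          (λ v → extB (⟦ M ⟧ φ v) (λ t → X (v , t)))
                          (λ v → extB (⟦ M ⟧ φ v) (λ t → Y (v , t)))
      ; V = λ p w → Frame.V M p (proj₁ w)
      }

    M , w ⊨ ⊤'        = ⊤
    M , w ⊨ atom p    = w ∈ Frame.V M p
    M , w ⊨ (¬' φ)    = ¬ (M , w ⊨ φ)
    M , w ⊨ (φ ∧' ψ)  = (M , w ⊨ φ) × (M , w ⊨ ψ)
    M , w ⊨ B a φ ψ   =
      Σ (Sub (Frame.W M)) λ Y →
        Frame.N M a w (⟦ M ⟧ φ) Y × (∀ v → v ∈ Y → M , v ⊨ ψ)
    M , w ⊨ ([ φ ] ψ) =
      (h : M , w ⊨ φ) → update M φ , (w , witnessT em h) ⊨ ψ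

-- K_a is the universal modality over [w]_a,
-- because N_a^w(X) is empty exactly when X ∩ [w]_a is: (c) and (d) rule out neighbourhoods of sets
-- missing [w]_a, and (sc) produces one otherwise. 4B and 5B hold since N is constant on [w]_a, C and
-- M since neighbourhoods of X lie inside X ∩ [w]_a, EC is (ec), SC is (sc), and D follows from (d)
-- together with the upward closure of N_a^w(X) inside X ∩ [w]_a that (sc) provides. For the
-- reduction axiom of B, the truth set of ψ in M^φ, read as a subset of W, is ⟦φ ∧ [φ]ψ⟧.
module Submission where

open import Defs
open import Level using (0ℓ)
open import Data.Nat using (ℕ)
open import Data.Fin using (Fin)
open import Axiom.ExcludedMiddle using (ExcludedMiddle)
open import Axiom.DoubleNegationElimination using (em⇒dne)
open import Data.Bool using (Bool; true; false; not; _∧_; T)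
open import Data.Bool.Properties using (T-irrelevant; T-≡; ¬-not; ⇔→≡)
open import Data.Unit using (tt)
open import Data.Empty using (⊥-elim)
open import Data.Sum using (_⊎_; inj₁; inj₂)
open import Data.Product using (Σ; ∃; _×_; _,_; proj₁; proj₂)
open import Function using (_∘_)
open import Function.Bundles using (_⇔_; mk⇔; Equivalence)
open import Function.Properties.Equivalence using ()
  renaming (refl to ⇔-refl; sym to ⇔-sym; trans to ⇔-trans)
open import Relation.Nullary using (¬_; yes; no; does)
open import Relation.Nullary.Decidable using (dec-true; dec-false; does-≡; does-⇔; ¬?; _×-dec_)
open import Relation.Binary.PropositionalEquality using (_≡_; refl; sym; trans; cong; cong₂; subst)

extB-≡ : ∀ b (f : T b → Bool) {c} → (b ≡ false → c ≡ false) → (∀ t → f t ≡ c) → extB b f ≡ c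
extB-≡ true  f _ same = same tt
extB-≡ false f c≡false _ = sym (c≡false refl)

extB≡true⇒ : ∀ b (f : T b → Bool) → extB b f ≡ true → Σ (T b) λ t → f t ≡ true
extB≡true⇒ true f e = tt , e

module Soundness (em : ExcludedMiddle 0ℓ) {P Ag : Set} (M : CNModel P Ag) where
  open Semantics em

  F : Frame P Ag
  F = CNModel.frame M
  open Frame F
  open IsCNModel (CNModel.isCN M)

  _⊩_ : W → Form P Ag → Set
  w ⊩ φ = F , w ⊨ φ

  dne : {A : Set} → ¬ ¬ A → A
  dne = em⇒dne em

  ⇒⁺ : {A B : Set} → (A → B) → ¬ (A × ¬ B)
  ⇒⁺ f (a , ¬b) = ¬b (f a)

  ⇒⁻ : {A B : Set} → ¬ (A × ¬ B) → A → B
  ⇒⁻ g a = dne λ ¬b → g (a , ¬b)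

  sub : (W → Set) → Sub W
  sub A v = does (em {A v})

  ∈-sub⁺ : ∀ A {v} → A v → v ∈ sub A
  ∈-sub⁺ A = dec-true em

  ∈-sub⁻ : ∀ A {v} → v ∈ sub A → A v
  ∈-sub⁻ A {v} e with em {A v}
  ... | yes a = a

  ∉-sub⁻ : ∀ A {v} → sub A v ≡ false → ¬ A v
  ∉-sub⁻ A e a with trans (sym e) (∈-sub⁺ A a)
  ... | ()

  ∈⟦⟧⁺ : ∀ φ {v} → v ⊩ φ → v ∈ ⟦ F ⟧ φ
  ∈⟦⟧⁺ φ = ∈-sub⁺ (_⊩ φ)

  ∈⟦⟧⁻ : ∀ φ {v} → v ∈ ⟦ F ⟧ φ → v ⊩ φ
  ∈⟦⟧⁻ φ = ∈-sub⁻ (_⊩ φ)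

  ⟦⟧-cong : ∀ {v} φ ψ → v ⊩ (φ ⇔' ψ) → (v ∈ ⟦ F ⟧ φ ⇔ v ∈ ⟦ F ⟧ ψ)
  ⟦⟧-cong φ ψ (φ⇒ψ , ψ⇒φ) = mk⇔ (∈⟦⟧⁺ ψ ∘ ⇒⁻ φ⇒ψ ∘ ∈⟦⟧⁻ φ) (∈⟦⟧⁺ φ ∘ ⇒⁻ ψ⇒φ ∘ ∈⟦⟧⁻ ψ)

  ⟦substP⟧ : ∀ σ τ w → ⟦ F ⟧ (substP σ τ) w ≡ evalP (λ i → ⟦ F ⟧ (σ i) w) τ
  ⟦substP⟧ σ (pv i)   w = refl
  ⟦substP⟧ σ p⊤       w = dec-true em tt
  ⟦substP⟧ σ (p¬ τ)   w = trans (does-≡ em (¬? em)) (cong not (⟦substP⟧ σ τ w))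
  ⟦substP⟧ σ (p∧ τ ρ) w =
    trans (does-≡ em (em ×-dec em)) (cong₂ _∧_ (⟦substP⟧ σ τ w) (⟦substP⟧ σ ρ w))

  cls-refl : ∀ {a w} → cls F a w w
  cls-refl _ _ = ⇔-refl

  cls-sym : ∀ {a w v} → cls F a w v → cls F a v w
  cls-sym w~v X Y = ⇔-sym (w~v X Y)

  ∅ : Sub W
  ∅ _ = false

  ｛_｝ : W → Sub W
  ｛ v ｝ = sub (_≡ v)

  Diff : Ag → W → Sub W → Sub W → W → Set
  Diff a w X Y v = v ∈ X × cls F a w v × ¬ v ∈ Y

  diff : Ag → W → Sub W → Sub W → Sub W
  diff a w X Y = sub (Diff a w X Y)

  diff-isDiff : ∀ {a w X Y} → IsDiff F a w X Y (diff a w X Y)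
  diff-isDiff {a} {w} {X} {Y} v = mk⇔ (∈-sub⁻ (Diff a w X Y)) (∈-sub⁺ (Diff a w X Y))

  diff-⊆cap : ∀ {a w X Y} → ⊆cap F a w (diff a w X Y) X
  diff-⊆cap {a} {w} {X} {Y} v d = let (x , w~v , _) = ∈-sub⁻ (Diff a w X Y) d in x , w~v

  DiffNotIn-intro : ∀ {a w X Y} → ¬ N a w X (diff a w X Y) → DiffNotIn F a w X Y
  DiffNotIn-intro {a} {w} {X} {Y} ¬n Z Z-isDiff n =
    ¬n (extN a w X X Z (diff a w X Y) (λ _ → refl) Z≐diff n)
    where
      Z≐diff : Z ≐ diff a w X Y
      Z≐diff v = ⇔→≡ (⇔-trans (Z-isDiff v) (⇔-sym (diff-isDiff {a} {w} {X} {Y} v)))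

  N⊆⟦⟧ : ∀ {a w} θ {Y v} → N a w (⟦ F ⟧ θ) Y → v ∈ Y → v ⊩ θ
  N⊆⟦⟧ {a} {w} θ {Y} {v} n y = ∈⟦⟧⁻ θ (proj₁ (c-ax a w _ Y n v y))

  N⊆cls : ∀ {a w X Y v} → N a w X Y → v ∈ Y → cls F a w v
  N⊆cls {a} {w} {X} {Y} {v} n y = proj₂ (c-ax a w X Y n v y)

  N-upward : ∀ {a w X Y Z} → N a w X Y → (∀ v → v ∈ Y → v ∈ Z) → ⊆cap F a w Z X → N a w X Z
  N-upward {a} {w} {X} {Y} {Z} n Y⊆Z Z⊆cap with em {∃ λ v → v ∈ Z × ¬ v ∈ Y}
  ... | yes new = sc-ax a w X Y Z (c-ax a w X Y n) Z⊆cap (d-ax a w X Y n) (Y⊆Z , new)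
  ... | no ¬new = extN a w X X Y Z (λ _ → refl) Y≐Z n
    where
      Y≐Z : Y ≐ Z
      Y≐Z v = ⇔→≡ (mk⇔ (Y⊆Z v) (λ z → dne λ ¬y → ¬new (v , z , ¬y)))

  N-empty : ∀ {a w X Y} → (∀ v → cls F a w v → ¬ v ∈ X) → ¬ N a w X Y
  N-empty {a} {w} {X} {Y} X∩[w]≡∅ n = d-ax a w X Y n Y Y-isDiff n
    where
      Y⊆∅ : ∀ v → ¬ v ∈ Y
      Y⊆∅ v y = let (x , w~v) = c-ax a w X Y n v y in X∩[w]≡∅ v w~v x

      Y-isDiff : IsDiff F a w X Y Y
      Y-isDiff v = mk⇔ (⊥-elim ∘ Y⊆∅ v) (λ (x , w~v , _) → ⊥-elim (X∩[w]≡∅ v w~v x))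

  -- If X ∩ [w]_a is not a neighbourhood, (sc) applied to ∅ ⊊ ｛ v ｝ makes ｛ v ｝ one.
  N-inhabited : ∀ {a w X v} → v ∈ X → cls F a w v → ∃ (N a w X)
  N-inhabited {a} {w} {X} {v} v∈X w~v with em {N a w X (diff a w X ∅)}
  ... | yes n = _ , n
  ... | no ¬n = ｛ v ｝ , sc-ax a w X ∅ ｛ v ｝ (λ _ ()) ｛v｝⊆cap (DiffNotIn-intro ¬n) ∅⊊｛v｝
    where
      ｛v｝⊆cap : ⊆cap F a w ｛ v ｝ X
      ｛v｝⊆cap u u∈｛v｝ with ∈-sub⁻ (_≡ v) u∈｛v｝
      ... | refl = v∈X , w~v

      ∅⊊｛v｝ : _⊊_ F ∅ ｛ v ｝
      ∅⊊｛v｝ = (λ _ ()) , v , ∈-sub⁺ (_≡ v) refl , λ ()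

  ⊩K⁺ : ∀ {a} φ {w} → (∀ v → cls F a w v → v ⊩ φ) → w ⊩ K a φ
  ⊩K⁺ φ ⊩φ (_ , n , _) = N-empty (λ v w~v v∈⟦¬φ⟧ → ∈⟦⟧⁻ (¬' φ) v∈⟦¬φ⟧ (⊩φ v w~v)) n

  ⊩K⁻ : ∀ {a} φ {w v} → w ⊩ K a φ → cls F a w v → v ⊩ φ
  ⊩K⁻ φ k w~v = dne λ ¬φ →
    let (Y , n) = N-inhabited (∈⟦⟧⁺ (¬' φ) ¬φ) w~v in k (Y , n , λ _ _ → tt)

  ⊩K̂⁻ : ∀ {a} φ {w} → w ⊩ K̂ a φ → ∃ λ v → cls F a w v × v ⊩ φ
  ⊩K̂⁻ φ k̂ = dne λ ∄v → k̂ (⊩K⁺ (¬' φ) λ v w~v ⊩φ → ∄v (v , w~v , ⊩φ))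

  ⊩B-cls : ∀ {a φ ψ w v} → cls F a w v → w ⊩ B a φ ψ → v ⊩ B a φ ψ
  ⊩B-cls {φ = φ} w~v (Y , n , Y⊩ψ) = Y , Equivalence.to (w~v (⟦ F ⟧ φ) Y) n , Y⊩ψ

  ⊩B⇒¬⊩B¬ : ∀ {a φ ψ w} → w ⊩ B a φ ψ → ¬ w ⊩ B a φ (¬' ψ)
  ⊩B⇒¬⊩B¬ {a} {φ} {w = w} (Y , n , Y⊩ψ) (Y' , n' , Y'⊩¬ψ) =
    d-ax a w X Y n (diff a w X Y) (diff-isDiff {a} {w} {X} {Y}) (N-upward n' Y'⊆diff diff-⊆cap)
    where
      X = ⟦ F ⟧ φ

      Y'⊆diff : ∀ v → v ∈ Y' → v ∈ diff a w X Y
      Y'⊆diff v y' = let (x , w~v) = c-ax a w X Y' n' v y' in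
        ∈-sub⁺ (Diff a w X Y) (x , w~v , λ y → Y'⊩¬ψ v y' (Y⊩ψ v y))

  ⊩SC : ∀ {a φ ψ χ w} → ¬ w ⊩ B a χ (¬' φ) → (∃ λ v → cls F a w v × v ⊩ (χ ∧' ¬' φ ∧' ψ)) →
        w ⊩ B a χ (φ ∨' ψ)
  ⊩SC {a} {φ} {ψ} {χ} {w} ¬B (v , w~v , v⊩χ , v⊮φ , v⊩ψ) = Z , N-Z , Z⊩φ∨ψ
    where
      X = ⟦ F ⟧ χ

      InY : W → Set
      InY u = u ∈ X × cls F a w u × u ⊩ φ

      InZ : W → Set
      InZ u = u ∈ sub InY ⊎ u ≡ v

      Y Z : Sub W
      Y = sub InY
      Z = sub InZ

      Y⊆cap : ⊆cap F a w Y X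
      Y⊆cap u y = let (x , w~u , _) = ∈-sub⁻ InY y in x , w~u

      Z⊆cap : ⊆cap F a w Z X
      Z⊆cap u z with ∈-sub⁻ InZ z
      ... | inj₁ y = Y⊆cap u y
      ... | inj₂ refl = ∈⟦⟧⁺ χ v⊩χ , w~v

      -- (X ∩ [w]_a) \ Y consists of ¬φ-worlds, so as a neighbourhood it would witness B_a(χ, ¬φ).
      Y-DiffNotIn : DiffNotIn F a w X Y
      Y-DiffNotIn D D-isDiff n = ¬B (D , n , λ u d u⊩φ →
        let (x , w~u , ¬y) = Equivalence.to (D-isDiff u) d in ¬y (∈-sub⁺ InY (x , w~u , u⊩φ)))

      Y⊊Z : _⊊_ F Y Z
      Y⊊Z = (λ u → ∈-sub⁺ InZ ∘ inj₁) , v , ∈-sub⁺ InZ (inj₂ refl) ,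
            λ y → v⊮φ (proj₂ (proj₂ (∈-sub⁻ InY y)))

      N-Z : N a w X Z
      N-Z = sc-ax a w X Y Z Y⊆cap Z⊆cap Y-DiffNotIn Y⊊Z

      Z⊩φ∨ψ : ∀ u → u ∈ Z → u ⊩ (φ ∨' ψ)
      Z⊩φ∨ψ u z with ∈-sub⁻ InZ z
      ... | inj₁ y = λ (¬φ , _) → ¬φ (proj₂ (proj₂ (∈-sub⁻ InY y)))
      ... | inj₂ refl = λ (_ , ¬ψ) → ¬ψ v⊩ψ

  module Announcement (φ : Form P Ag) where
    F^φ : Frame P Ag
    F^φ = update F φ

    _⊩^φ_ : Frame.W F^φ → Form P Ag → Set
    v ⊩^φ ψ = F^φ , v ⊨ ψ

    T⟦φ⟧⁻ : ∀ {v} → T (⟦ F ⟧ φ v) → v ⊩ φ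
    T⟦φ⟧⁻ = ∈⟦⟧⁻ φ ∘ Equivalence.to T-≡

    ⊩^φ-witness-irrelevant : ∀ {v ψ} (t t' : T (⟦ F ⟧ φ v)) → (v , t) ⊩^φ ψ → (v , t') ⊩^φ ψ
    ⊩^φ-witness-irrelevant {v} {ψ} t t' = subst (λ t → (v , t) ⊩^φ ψ) (T-irrelevant t t')

    lift : Sub (Frame.W F^φ) → Sub W
    lift X v = extB (⟦ F ⟧ φ v) (λ t → X (v , t))

    lift-⟦⟧ : ∀ ψ → lift (⟦ F^φ ⟧ ψ) ≐ ⟦ F ⟧ (φ ∧' [ φ ] ψ)
    lift-⟦⟧ ψ v = extB-≡ (⟦ F ⟧ φ v) _
      (λ v∉⟦φ⟧ → dec-false em λ (v⊩φ , _) → ∉-sub⁻ (_⊩ φ) v∉⟦φ⟧ v⊩φ)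
      (λ t → does-⇔ (mk⇔ (λ s → T⟦φ⟧⁻ t , λ h → ⊩^φ-witness-irrelevant t _ s)
                          (λ (h , s) → ⊩^φ-witness-irrelevant _ t (s h))) em em)

    lift-proj₁ : ∀ Y → (∀ v → v ∈ Y → v ⊩ φ) → lift (Y ∘ proj₁) ≐ Y
    lift-proj₁ Y Y⊩φ v = extB-≡ (⟦ F ⟧ φ v) _
      (λ v∉⟦φ⟧ → ¬-not λ y → ∉-sub⁻ (_⊩ φ) v∉⟦φ⟧ (Y⊩φ v y)) (λ _ → refl)

    ⊩[φ]B⇒ : ∀ {a ψ χ w} → w ⊩ ([ φ ] B a ψ χ) → w ⊩ φ → w ⊩ B a (φ ∧' [ φ ] ψ) ([ φ ] χ)
    ⊩[φ]B⇒ {a} {ψ} {w = w} ⊩[φ]B w⊩φ = let (Y , n , Y⊩χ) = ⊩[φ]B w⊩φ in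
      lift Y , extN a w _ _ _ _ (lift-⟦⟧ ψ) (λ _ → refl) n ,
      λ v y _ → let (t , y') = extB≡true⇒ _ _ y in ⊩^φ-witness-irrelevant t _ (Y⊩χ (v , t) y')

    ⇒⊩[φ]B : ∀ {a ψ χ w} → (w ⊩ φ → w ⊩ B a (φ ∧' [ φ ] ψ) ([ φ ] χ)) → w ⊩ ([ φ ] B a ψ χ)
    ⇒⊩[φ]B {a} {ψ} {w = w} ⊩B w⊩φ = let (Y , n , Y⊩[φ]χ) = ⊩B w⊩φ in
      Y ∘ proj₁ ,
      extN a w _ _ _ _ (λ v → sym (lift-⟦⟧ ψ v)) (λ v → sym (lift-proj₁ Y (Y⊩φ n) v)) n ,
      λ (v , t) y → ⊩^φ-witness-irrelevant _ t (Y⊩[φ]χ v y (T⟦φ⟧⁻ t))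
      where
        Y⊩φ : ∀ {Y} → N a w (⟦ F ⟧ (φ ∧' [ φ ] ψ)) Y → ∀ v → v ∈ Y → v ⊩ φ
        Y⊩φ n _ = proj₁ ∘ N⊆⟦⟧ (φ ∧' [ φ ] ψ) n

  open Announcement using (⊩^φ-witness-irrelevant; ⊩[φ]B⇒; ⇒⊩[φ]B)

  sound : ∀ {φ} → ⊢ φ → ∀ w → w ⊩ φ
  sound (Taut τ taut σ) w = ∈⟦⟧⁻ (substP σ τ) (trans (⟦substP⟧ σ τ w) (taut _))
  sound (DistK a φ ψ) w = ⇒⁺ λ k[φ⇒ψ] → ⇒⁺ λ kφ → ⊩K⁺ ψ λ _ w~v →
    ⇒⁻ (⊩K⁻ (φ ⇒ ψ) k[φ⇒ψ] w~v) (⊩K⁻ φ kφ w~v)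
  sound (T-ax a φ) w = ⇒⁺ λ kφ → ⊩K⁻ φ kφ cls-refl
  sound (5B a φ ψ) w = ⇒⁺ λ b → ⊩K⁺ (B a φ ψ) λ _ w~v → ⊩B-cls w~v b
  sound (4B a φ ψ) w = ⇒⁺ λ ¬b → ⊩K⁺ (¬' B a φ ψ) λ _ w~v → ¬b ∘ ⊩B-cls (cls-sym w~v)
  sound (D-ax a φ ψ) w = ⇒⁺ ⊩B⇒¬⊩B¬
  sound (EC a φ ψ χ) w = ⇒⁺ λ k → ⇒⁺ λ (Y , n , Y⊩χ) →
    Y , Equivalence.to (ec-ax a w _ _ (λ _ w~v → ⟦⟧-cong φ ψ (⊩K⁻ (φ ⇔' ψ) k w~v)) Y) n , Y⊩χ
  sound (M-ax a φ ψ χ) w = ⇒⁺ λ k → ⇒⁺ λ (Y , n , Y⊩φ) →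
    Y , n , λ v y → ⇒⁻ (⊩K⁻ (φ ⇒ ψ) k (N⊆cls n y)) (Y⊩φ v y)
  sound (C-ax a φ ψ) w = ⇒⁺ λ (Y , n , Y⊩ψ) → Y , n , λ v y → N⊆⟦⟧ φ n y , Y⊩ψ v y
  sound (SC a φ ψ χ) w = ⇒⁺ λ (¬B , k̂) → ⊩SC ¬B (⊩K̂⁻ (χ ∧' ¬' φ ∧' ψ) k̂)
  sound (R⊤ φ) w = ⇒⁺ (λ _ → tt) , ⇒⁺ (λ _ _ → tt)
  sound (Ratom φ p) w = ⇒⁺ ⇒⁺ , ⇒⁺ ⇒⁻
  sound (R¬ φ ψ) w =
    ⇒⁺ (λ ⊩[φ]¬ψ → ⇒⁺ λ h ⊩[φ]ψ → ⊩[φ]¬ψ h (⊩[φ]ψ h)) ,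
    ⇒⁺ (λ ⊩φ⇒¬[φ]ψ h ⊩ψ → ⇒⁻ ⊩φ⇒¬[φ]ψ h λ _ → ⊩^φ-witness-irrelevant φ _ _ ⊩ψ)
  sound (R∧ φ ψ χ) w =
    ⇒⁺ (λ ⊩[φ]∧ → proj₁ ∘ ⊩[φ]∧ , proj₂ ∘ ⊩[φ]∧) ,
    ⇒⁺ (λ (⊩[φ]ψ , ⊩[φ]χ) h → ⊩[φ]ψ h , ⊩[φ]χ h)
  sound (RB φ a ψ χ) w = ⇒⁺ (⇒⁺ ∘ ⊩[φ]B⇒ φ) , ⇒⁺ (⇒⊩[φ]B φ ∘ ⇒⁻)
  sound (MP ⊢φ⇒ψ ⊢φ) w = ⇒⁻ (sound ⊢φ⇒ψ w) (sound ⊢φ w)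
  sound (Nec a {φ} ⊢φ) w = ⊩K⁺ φ λ v _ → sound ⊢φ v

theorem6 : (em : ExcludedMiddle 0ℓ) {P : Set} {n : ℕ} (φ : Form P (Fin n)) →
           ⊢ φ → (M : CNModel P (Fin n)) (w : Frame.W (CNModel.frame M)) →
           Semantics._,_⊨_ em (CNModel.frame M) w φ
theorem6 em φ ⊢φ M = Soundness.sound em M ⊢φ
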